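{- Let $G$ be a finite, simple, connected graph. Then $\overrightarrow{\beta}(G,1)\le 1$ (equivalently, $\overrightarrow{\beta}(G,1)=1$) if and only if $G$ contains at most one cycle.
   Context: Firefighting on oriented graphs: an orientation $\overrightarrow{G}$ of a finite simple graph $G$ replaces each edge $uv$ by exactly one of the arcs $\overrightarrow{uv}$, $\overrightarrow{vu}$. Let $f\ge 1$ be an integer. A fire breaks out at a vertex $v$ at time $1$ ($v$ burns). At the end of each time unit, the firefighters permanently protect up to $f$ vertices that are neither burning nor already protected. At the next time unit, every vertex that is neither burning nor protected and is an out-neighbour of a burning vertex starts to burn. The process ends when no new vertex can burn. $\beta(\overrightarrow{G},f)$ is the maximum, over all starting vertices $v$, of the minimum, over all protection strategies, of the number of vertices that burn. $\overrightarrow{\beta}(G,f)$ is the minimum of $\beta(\overrightarrow{G},f)$ over all orientations $\overrightarrow{G}$ of $G$. (Always $\overrightarrow{\beta}(G,f)\ge 1$.) -}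

module Defs where

open import Data.Nat using (ℕ; zero; suc; _≤_)
open import Data.Bool using (Bool; true; false; _∧_; _∨_; not)
open import Data.Fin using (Fin; zero; suc; inject₁; fromℕ)
open import Data.Fin.Subset using (Subset; ⁅_⁆; ⊥; _∪_; _∩_; ∣_∣; Empty)
open import Data.Vec using (tabulate; lookup)
open import Data.Product using (Σ; ∃; _×_; _,_)
open import Data.Sum using (_⊎_)
open import Relation.Binary.PropositionalEquality using (_≡_)
open import Relation.Binary.Construct.Closure.ReflexiveTransitive using (Star)
open import Function.Definitions using (Injective)

record Graph (n : ℕ) : Set where
  field
    adj     : Fin n → Fin n → Bool
    sym     : ∀ u v → adj u v ≡ adj v u
    irrefl  : ∀ u → adj u u ≡ false
open Graph public

Edge : ∀ {n} → Graph n → Fin n → Fin n → Set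
Edge G u v = adj G u v ≡ true

Connected : ∀ {n} → Graph n → Set
Connected G = ∀ u v → Star (Edge G) u v

record Orientation {n : ℕ} (G : Graph n) : Set where
  field
    arc        : Fin n → Fin n → Bool
    arc⇒edge   : ∀ u v → arc u v ≡ true → Edge G u v
    edge⇒arc   : ∀ u v → Edge G u v → (arc u v ≡ true) ⊎ (arc v u ≡ true)
    antisym    : ∀ u v → arc u v ≡ true → arc v u ≡ false
open Orientation public

anyFin : ∀ {n} → (Fin n → Bool) → Bool
anyFin {zero}  p = false
anyFin {suc n} p = p zero ∨ anyFin (λ i → p (suc i))

record State (n : ℕ) : Set where
  constructor ⟨_,_⟩
  field
    burning   : Subset n
    protected : Subset n
open State public

-- A protection strategy: sigma t is the set of vertices protected at
-- the end of time unit (t+1).  (Since the process is deterministic, a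
-- fixed sequence of choices loses no generality over adaptive ones.)
Strategy : ℕ → Set
Strategy n = ℕ → Subset n

step : ∀ {n} {G : Graph n} → Orientation G → Subset n → State n → State n
step {n} O S ⟨ B , P ⟩ = ⟨ B ∪ new , P' ⟩
  where
    P' = P ∪ S
    new : Subset n
    new = tabulate (λ w → not (lookup P' w) ∧ not (lookup B w)
                           ∧ anyFin (λ u → lookup B u ∧ arc O u w))

-- state at time (t+1), fire starting at v at time 1.
run : ∀ {n} {G : Graph n} → Orientation G → Strategy n → Fin n → ℕ → State n
run O σ v zero    = ⟨ ⁅ v ⁆ , ⊥ ⟩
run O σ v (suc t) = step O (σ t) (run O σ v t)

Valid : ∀ {n} {G : Graph n} → Orientation G → ℕ → Fin n → Strategy n → Set
Valid O f v σ = ∀ t → ∣ σ t ∣ ≤ f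
                    × Empty (σ t ∩ (burning (run O σ v t) ∪ protected (run O σ v t)))

βO≤ : ∀ {n} {G : Graph n} → Orientation G → ℕ → ℕ → Set
βO≤ {n} O f k = ∀ (v : Fin n) → Σ (Strategy n) λ σ →
                   Valid O f v σ × (∀ t → ∣ burning (run O σ v t) ∣ ≤ k)

β⃗≤ : ∀ {n} → Graph n → ℕ → ℕ → Set
β⃗≤ G f k = Σ (Orientation G) λ O → βO≤ O f k

-- A cycle of length m+3: injective vertex sequence, consecutive vertices
-- adjacent, last adjacent to first.
record Cycle {n : ℕ} (G : Graph n) : Set where
  field
    len      : ℕ
    vtx      : Fin (suc (suc (suc len))) → Fin n
    inj      : Injective _≡_ _≡_ vtx
    steps    : ∀ (i : Fin (suc (suc len))) → Edge G (vtx (inject₁ i)) (vtx (suc i))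
    closing  : Edge G (vtx (fromℕ (suc (suc len)))) (vtx zero)
open Cycle public

CycStep : ∀ {n} {G : Graph n} → Cycle G → Fin n → Fin n → Set
CycStep c u v = (∃ λ i → vtx c (inject₁ i) ≡ u × vtx c (suc i) ≡ v)
              ⊎ (vtx c (fromℕ _) ≡ u × vtx c zero ≡ v)

CycEdge : ∀ {n} {G : Graph n} → Cycle G → Fin n → Fin n → Set
CycEdge c u v = CycStep c u v ⊎ CycStep c v u

-- G contains at most one cycle: any two cycles have the same edge set
-- (hence are the same subgraph).
AtMostOneCycle : ∀ {n} → Graph n → Set
AtMostOneCycle G = ∀ (c₁ c₂ : Cycle G) → ∀ u v →
                     (CycEdge c₁ u v → CycEdge c₂ u v) × (CycEdge c₂ u v → CycEdge c₁ u v)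

-- Both directions go through orientations in which every vertex has out-degree ≤ 1.
-- (1) For an orientation O, β(O, 1) ≤ 1 iff O has out-degree ≤ 1.  If the origin v of
--     the fire has two out-neighbours, the single firefighter saves at most one of
--     them and the other burns at time 2; conversely, protecting the unique
--     out-neighbour of v at time 1 stops the fire at once.
-- (2) With out-degree ≤ 1 every cycle is a directed cycle which no arc leaves, and in
--     a connected graph every vertex has an arc-walk onto any given cycle.  Hence any
--     two cycles meet, and two cycles through a common vertex have the same edges.
-- (3) A graph with at most one cycle has a parent map (each vertex points to at most
--     one neighbour, each edge is covered by exactly one pointer), which is an
--     orientation of out-degree ≤ 1.  Parent maps with a prescribed root are built by
--     deleting a non-branching vertex and recursing; if every other vertex branches, a
--     greedy walk finds a cycle instead, and then one edge of the (unique) cycle is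
--     deleted and restored as a pointer out of the root.
module Submission where

open import Defs hiding (sym)

open import Data.Bool using (Bool; true; false; _∧_; not)
open import Data.Bool.Properties using (not-injective)
import Data.Bool.Properties
open import Data.Empty using (⊥-elim)
open import Data.Fin using (Fin; zero; suc; _≟_; inject₁; fromℕ; punchIn; punchOut)
open import Data.Fin.Properties
  using (suc-injective; inject₁-injective; any?; injective⇒≤;
         punchIn-injective; punchInᵢ≢i; punchIn-punchOut; punchOut-punchIn; punchOut-cong)
open import Data.Fin.Subset using (Subset; _∈_; _∉_; _⊆_; _∪_; _∩_; _-_; ⁅_⁆; ∣_∣)
  renaming (⊥ to ∅)
open import Data.Fin.Subset.Properties
  using (_∈?_; nonempty?; Empty-unique; ∉⊥; ∣⊥∣≡0; x∈⁅x⁆; x∈⁅y⁆⇒x≡y; x≢y⇒x∉⁅y⁆; ∣⁅x⁆∣≡1;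
         p⊆q⇒∣p∣≤∣q∣; x∈p⇒∣p-x∣<∣p∣; x∈p∧x≢y⇒x∈p-y; x∈p∪q⁺; x∈p∪q⁻; x∈p∩q⁻; p⊆p∪q)
open import Data.Nat using (ℕ; zero; suc; _+_; _≤_; z≤n)
open import Data.Nat.Properties using (≤-trans; ≤-<-trans; <-≤-trans; n≮n; +-suc; m≤m+n)
open import Data.Product using (Σ; ∃; _×_; _,_; proj₁; proj₂)
open import Data.Sum using (_⊎_; inj₁; inj₂; [_,_]′)
import Data.Sum
open import Data.Maybe using (Maybe; just; nothing)
import Data.Maybe
open import Data.Maybe.Properties using (just-injective)
open import Data.Vec using (tabulate; lookup)
open import Data.Vec.Properties using (lookup∘tabulate; lookup⇒[]=; []=⇒lookup)
open import Function using (_∘_; id; flip)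
open import Function.Definitions using (Injective)
open import Relation.Binary.Construct.Closure.ReflexiveTransitive using (Star; ε; _◅_; _◅◅_; reverse)
open import Relation.Nullary using (¬_; Dec; yes; no; does; contradiction)
open import Relation.Nullary.Decidable
  using (dec-true; dec-false; decidable-stable; toSum; _×-dec_; _⊎-dec_; ¬?)
open import Relation.Binary.PropositionalEquality using (_≡_; _≢_; refl; sym; trans; cong; cong₂; subst)

edge-sym : ∀ {n} (G : Graph n) {u w} → Edge G u w → Edge G w u
edge-sym G {u} {w} e = trans (Graph.sym G w u) e

edge⇒≢ : ∀ {n} (G : Graph n) {u w} → Edge G u w → u ≢ w
edge⇒≢ G {u} e refl = contradiction (trans (sym (irrefl G u)) e) λ ()

Arc : ∀ {n} {G : Graph n} → Orientation G → Fin n → Fin n → Set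
Arc O u w = arc O u w ≡ true

arc⇒≢ : ∀ {n} {G : Graph n} (O : Orientation G) {u w} → Arc O u w → u ≢ w
arc⇒≢ {G = G} O {u} {w} a = edge⇒≢ G (arc⇒edge O u w a)

OutDegree≤1 : ∀ {n} {G : Graph n} → Orientation G → Set
OutDegree≤1 {n} O = ∀ {v a b : Fin n} → Arc O v a → Arc O v b → a ≡ b

-- A subset of size ≤ 1 has at most one member: removing one member x leaves a
-- strictly smaller set, which still contains any other member y.
∣p∣≤1⇒unique : ∀ {n} {p : Subset n} {x y} → ∣ p ∣ ≤ 1 → x ∈ p → y ∈ p → x ≡ y
∣p∣≤1⇒unique {p = p} {x} {y} ∣p∣≤1 x∈p y∈p with x ≟ y
... | yes x≡y = x≡y
... | no x≢y = contradiction (<-≤-trans (≤-<-trans 1≤∣p-x∣ (x∈p⇒∣p-x∣<∣p∣ x∈p)) ∣p∣≤1) (n≮n 1)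
  where
  ⁅y⁆⊆p-x : ⁅ y ⁆ ⊆ p - x
  ⁅y⁆⊆p-x z∈⁅y⁆ = subst (_∈ p - x) (sym (x∈⁅y⁆⇒x≡y y z∈⁅y⁆)) (x∈p∧x≢y⇒x∈p-y y∈p (x≢y ∘ sym))
  1≤∣p-x∣ : 1 ≤ ∣ p - x ∣
  1≤∣p-x∣ = subst (_≤ ∣ p - x ∣) (∣⁅x⁆∣≡1 y) (p⊆q⇒∣p∣≤∣q∣ ⁅y⁆⊆p-x)

unique⇒∣p∣≤1 : ∀ {n} {p : Subset n} → (∀ {x y} → x ∈ p → y ∈ p → x ≡ y) → ∣ p ∣ ≤ 1
unique⇒∣p∣≤1 {n} {p} unique with nonempty? p
... | yes (x , x∈p) = subst (∣ p ∣ ≤_) (∣⁅x⁆∣≡1 x) (p⊆q⇒∣p∣≤∣q∣ p⊆⁅x⁆)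
  where
  p⊆⁅x⁆ : p ⊆ ⁅ x ⁆
  p⊆⁅x⁆ z∈p = subst (_∈ ⁅ x ⁆) (unique x∈p z∈p) (x∈⁅x⁆ x)
... | no p-empty = subst (_≤ 1) (sym (trans (cong ∣_∣ (Empty-unique p-empty)) (∣⊥∣≡0 n))) z≤n

∈-tabulate⁺ : ∀ {n} (f : Fin n → Bool) {w} → f w ≡ true → w ∈ tabulate f
∈-tabulate⁺ f {w} fw = lookup⇒[]= w (tabulate f) (trans (lookup∘tabulate f w) fw)

∈-tabulate⁻ : ∀ {n} (f : Fin n → Bool) {w} → w ∈ tabulate f → f w ≡ true
∈-tabulate⁻ f {w} w∈ = trans (sym (lookup∘tabulate f w)) ([]=⇒lookup w∈)

∉⇒lookup-false : ∀ {n} {p : Subset n} {w} → w ∉ p → lookup p w ≡ false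
∉⇒lookup-false {p = p} {w} w∉p with lookup p w in eq
... | true = contradiction (lookup⇒[]= w p eq) w∉p
... | false = refl

lookup-false⇒∉ : ∀ {n} {p : Subset n} {w} → lookup p w ≡ false → w ∉ p
lookup-false⇒∉ eq w∈p = contradiction (trans (sym eq) ([]=⇒lookup w∈p)) λ ()

anyFin⁺ : ∀ {n} (f : Fin n → Bool) {u} → f u ≡ true → anyFin f ≡ true
anyFin⁺ f {zero} fu rewrite fu = refl
anyFin⁺ f {suc u} fu with f zero
... | true = refl
... | false = anyFin⁺ (f ∘ suc) fu

anyFin⁻ : ∀ {n} (f : Fin n → Bool) → anyFin f ≡ true → ∃ λ u → f u ≡ true
anyFin⁻ {suc n} f any with f zero in eq
... | true = zero , eq
... | false with anyFin⁻ (f ∘ suc) any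
... | u , fu = suc u , fu

∧-true⁻ : ∀ x y → x ∧ y ≡ true → x ≡ true × y ≡ true
∧-true⁻ true y y≡true = refl , y≡true

module _ {n} {G : Graph n} (O : Orientation G) (S B P : Subset n) where

  burning-step⁻ : ∀ {w} → w ∈ burning (step O S ⟨ B , P ⟩) →
                  w ∈ B ⊎ (w ∉ P ∪ S × ∃ λ u → u ∈ B × Arc O u w)
  burning-step⁻ {w} w∈ with x∈p∪q⁻ B _ w∈
  ... | inj₁ w∈B = inj₁ w∈B
  ... | inj₂ w∈new
    with ∧-true⁻ _ _ (∈-tabulate⁻ _ w∈new)
  ... | unprotected , rest
    with anyFin⁻ _ (proj₂ (∧-true⁻ _ _ rest))
  ... | u , burning-in-neighbour
    with ∧-true⁻ _ _ burning-in-neighbour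
  ... | u∈B , arc-uw =
    inj₂ (lookup-false⇒∉ (not-injective unprotected) , u , lookup⇒[]= u B u∈B , arc-uw)

  burning-step⁺ : ∀ {u w} → w ∉ B → w ∉ P ∪ S → u ∈ B → Arc O u w → w ∈ burning (step O S ⟨ B , P ⟩)
  burning-step⁺ {u} {w} w∉B w∉P∪S u∈B arc-uw = x∈p∪q⁺ (inj₂ (∈-tabulate⁺ _ ignites))
    where
    ignites : not (lookup (P ∪ S) w) ∧ not (lookup B w) ∧ anyFin (λ z → lookup B z ∧ arc O z w) ≡ true
    ignites rewrite ∉⇒lookup-false w∉P∪S | ∉⇒lookup-false w∉B =
      anyFin⁺ _ {u} (subst (λ b → b ∧ arc O u w ≡ true) (sym ([]=⇒lookup u∈B)) arc-uw)

  burning-grows : ∀ {w} → w ∈ B → w ∈ burning (step O S ⟨ B , P ⟩)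
  burning-grows w∈B = x∈p∪q⁺ (inj₁ w∈B)

-- (1) β(O, 1) ≤ 1 holds exactly when O has out-degree at most 1.

ignites-at-time-2 : ∀ {n} {G : Graph n} (O : Orientation G) (σ : Strategy n) {v c} →
                    Arc O v c → c ∉ σ 0 → c ∈ burning (run O σ v 1)
ignites-at-time-2 O σ {v} {c} arc-vc c∉σ₀ =
  burning-step⁺ O (σ 0) ⁅ v ⁆ ∅ (x≢y⇒x∉⁅y⁆ (arc⇒≢ O arc-vc ∘ sym)) c∉∅∪σ₀ (x∈⁅x⁆ v) arc-vc
  where
  c∉∅∪σ₀ : c ∉ ∅ ∪ σ 0
  c∉∅∪σ₀ c∈ with x∈p∪q⁻ ∅ (σ 0) c∈
  ... | inj₁ c∈∅ = ∉⊥ c∈∅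
  ... | inj₂ c∈σ₀ = c∉σ₀ c∈σ₀

-- If one firefighter can hold every fire to a single vertex, out-degrees are ≤ 1:
-- of two out-neighbours of the origin at most one is protected at time 1, so
-- the other burns at time 2 together with the origin.
contained⇒OutDegree≤1 : ∀ {n} {G : Graph n} (O : Orientation G) → βO≤ O 1 1 → OutDegree≤1 O
contained⇒OutDegree≤1 O contained {v} {a} {b} arc-va arc-vb with a ≟ b
... | yes a≡b = a≡b
... | no a≢b with contained v
... | σ , valid , bounded with unprotected-out-neighbour
  where
  unprotected-out-neighbour : ∃ λ c → Arc O v c × c ∉ σ 0
  unprotected-out-neighbour with a ∈? σ 0 | b ∈? σ 0
  ... | no a∉σ₀ | _ = a , arc-va , a∉σ₀
  ... | yes _ | no b∉σ₀ = b , arc-vb , b∉σ₀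
  ... | yes a∈σ₀ | yes b∈σ₀ = contradiction (∣p∣≤1⇒unique (proj₁ (valid 0)) a∈σ₀ b∈σ₀) a≢b
... | c , arc-vc , c∉σ₀ =
  contradiction (∣p∣≤1⇒unique (bounded 1) (ignites-at-time-2 O σ arc-vc c∉σ₀) v-burns) (arc⇒≢ O arc-vc ∘ sym)
  where
  v-burns : v ∈ burning (run O σ v 1)
  v-burns = burning-grows O (σ 0) ⁅ v ⁆ ∅ (x∈⁅x⁆ v)

out : ∀ {n} {G : Graph n} → Orientation G → Fin n → Subset n
out O v = tabulate (arc O v)

-- Conversely, with out-degree ≤ 1 the firefighter protects the (at most one)
-- out-neighbour of the origin at time 1 and nothing afterwards; the fire never spreads.
module GuardOrigin {n} {G : Graph n} (O : Orientation G) (outdeg : OutDegree≤1 O) (v : Fin n) where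

  guard : Strategy n
  guard zero = out O v
  guard (suc t) = ∅

  guarded : ∀ t → out O v ⊆ protected (run O guard v t) ∪ guard t
  guarded zero w∈out = x∈p∪q⁺ (inj₂ w∈out)
  guarded (suc t) w∈out = p⊆p∪q ∅ (guarded t w∈out)

  only-origin-burns : ∀ t {w} → w ∈ burning (run O guard v t) → w ≡ v
  only-origin-burns zero w∈ = x∈⁅y⁆⇒x≡y v w∈
  only-origin-burns (suc t) w∈ with burning-step⁻ O (guard t) _ _ w∈
  ... | inj₁ w∈B = only-origin-burns t w∈B
  ... | inj₂ (w-unprotected , u , u∈B , arc-uw) with only-origin-burns t u∈B
  ... | refl = ⊥-elim (w-unprotected (guarded t (∈-tabulate⁺ (arc O v) arc-uw)))

  guard-valid : Valid O 1 v guard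
  guard-valid zero =
      unique⇒∣p∣≤1 (λ a∈ b∈ → outdeg (∈-tabulate⁻ (arc O v) a∈) (∈-tabulate⁻ (arc O v) b∈))
    , λ (w , w∈) → let w∈out , w∈B∪P = x∈p∩q⁻ (out O v) _ w∈ in
        [ (λ w∈⁅v⁆ → arc⇒≢ O (∈-tabulate⁻ (arc O v) w∈out) (sym (x∈⁅y⁆⇒x≡y v w∈⁅v⁆))) , ∉⊥ ]′
          (x∈p∪q⁻ _ ∅ w∈B∪P)
  guard-valid (suc t) = subst (_≤ 1) (sym (∣⊥∣≡0 n)) z≤n , λ (w , w∈) → ∉⊥ (proj₁ (x∈p∩q⁻ ∅ _ w∈))

OutDegree≤1⇒contained : ∀ {n} {G : Graph n} (O : Orientation G) → OutDegree≤1 O → βO≤ O 1 1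
OutDegree≤1⇒contained O outdeg v =
    guard , guard-valid
  , λ t → unique⇒∣p∣≤1 (λ a∈ b∈ → trans (only-origin-burns t a∈) (sym (only-origin-burns t b∈)))
  where open GuardOrigin O outdeg v

-- (2) A connected graph with an orientation of out-degree ≤ 1 has at most one cycle.

inject₁-or-last : ∀ {K} (i : Fin (suc K)) → (∃ λ j → i ≡ inject₁ j) ⊎ i ≡ fromℕ K
inject₁-or-last {zero} zero = inj₂ refl
inject₁-or-last {suc K} zero = inj₁ (zero , refl)
inject₁-or-last {suc K} (suc i) with inject₁-or-last i
... | inj₁ (j , i≡j) = inj₁ (suc j , cong suc i≡j)
... | inj₂ i≡last = inj₂ (cong suc i≡last)

inject₁²≢suc² : ∀ {N} (i : Fin N) → inject₁ (inject₁ i) ≢ suc (suc i)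
inject₁²≢suc² (suc i) eq = inject₁²≢suc² i (suc-injective eq)

IsWalk : ∀ {n k} → Graph n → (Fin (suc k) → Fin n) → Set
IsWalk G x = ∀ i → Edge G (x (inject₁ i)) (x (suc i))

NonBacktracking : ∀ {n N} → (Fin (suc (suc N)) → Fin n) → Set
NonBacktracking x = ∀ i → x (inject₁ (inject₁ i)) ≢ x (suc (suc i))

module _ {V : Set} (R : V → V → Set) where

  walk-from-first : ∀ {K} (x : Fin (suc K) → V) → (∀ i → R (x (inject₁ i)) (x (suc i))) →
                    ∀ j → Star R (x zero) (x j)
  walk-from-first x links zero = ε
  walk-from-first {suc K} x links (suc j) = links zero ◅ walk-from-first (x ∘ suc) (links ∘ suc) j

  walk-to-last : ∀ {K} (x : Fin (suc K) → V) → (∀ i → R (x (inject₁ i)) (x (suc i))) →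
                 ∀ j → Star R (x j) (x (fromℕ K))
  walk-to-last {zero} x links zero = ε
  walk-to-last {suc K} x links zero = links zero ◅ walk-to-last (x ∘ suc) (links ∘ suc) zero
  walk-to-last {suc K} x links (suc j) = walk-to-last (x ∘ suc) (links ∘ suc) j

OnCycle : ∀ {n} {G : Graph n} → Cycle G → Fin n → Set
OnCycle c u = ∃ λ i → vtx c i ≡ u

cycStep-ends : ∀ {n} {G : Graph n} (c : Cycle G) {u w} → CycStep c u w → OnCycle c u × OnCycle c w
cycStep-ends c (inj₁ (i , u≡ , w≡)) = (inject₁ i , u≡) , (suc i , w≡)
cycStep-ends c (inj₂ (u≡ , w≡)) = (fromℕ _ , u≡) , (zero , w≡)

cycEdge-ends : ∀ {n} {G : Graph n} (c : Cycle G) {u w} → CycEdge c u w → OnCycle c u × OnCycle c w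
cycEdge-ends c (inj₁ s) = cycStep-ends c s
cycEdge-ends c (inj₂ s) = let u-on , w-on = cycStep-ends c s in w-on , u-on

cycEdge-sym : ∀ {n} {G : Graph n} (c : Cycle G) {u w} → CycEdge c u w → CycEdge c w u
cycEdge-sym c (inj₁ s) = inj₂ s
cycEdge-sym c (inj₂ s) = inj₁ s

cycEdge⇒Edge : ∀ {n} {G : Graph n} (c : Cycle G) {u w} → CycEdge c u w → Edge G u w
cycEdge⇒Edge {G = G} c (inj₁ s) = cycStep⇒Edge c s
  where
  cycStep⇒Edge : ∀ (c : Cycle G) {u w} → CycStep c u w → Edge G u w
  cycStep⇒Edge c (inj₁ (i , refl , refl)) = steps c i
  cycStep⇒Edge c (inj₂ (refl , refl)) = closing c
cycEdge⇒Edge {G = G} c (inj₂ s) = edge-sym G (cycEdge⇒Edge c (inj₁ s))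

module OneCycle {n} {G : Graph n} (O : Orientation G) (outdeg : OutDegree≤1 O) where

  BackwardAt : ∀ {N} → (Fin (suc (suc N)) → Fin n) → Fin (suc N) → Set
  BackwardAt x i = Arc O (x (suc i)) (x (inject₁ i))

  -- On a non-backtracking walk, once an edge is traversed backwards so is the next
  -- one: x_{i+1} already has its out-neighbour x_i ≠ x_{i+2}.
  backward-from-start : ∀ {N} (x : Fin (suc (suc N)) → Fin n) → IsWalk G x → NonBacktracking x →
                        BackwardAt x zero → ∀ i → BackwardAt x i
  backward-from-start x walk nb back₀ zero = back₀
  backward-from-start {suc N} x walk nb back₀ (suc i) =
    backward-from-start (x ∘ suc) (walk ∘ suc) (nb ∘ suc) back₁ i
    where
    back₁ : BackwardAt (x ∘ suc) zero
    back₁ with edge⇒arc O _ _ (walk (suc zero))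
    ... | inj₁ forward₁ = contradiction (outdeg back₀ forward₁) (nb zero)
    ... | inj₂ backward₁ = backward₁

  backward-at-end : ∀ {N} (x : Fin (suc (suc N)) → Fin n) → IsWalk G x → NonBacktracking x →
                    ∀ i → BackwardAt x i → BackwardAt x (fromℕ N)
  backward-at-end {N} x walk nb zero back = backward-from-start x walk nb back (fromℕ N)
  backward-at-end {suc N} x walk nb (suc i) back = backward-at-end (x ∘ suc) (walk ∘ suc) (nb ∘ suc) i back

  cycle-gaps : (c : Cycle G) → NonBacktracking (vtx c)
  cycle-gaps c i eq = inject₁²≢suc² i (inj c eq)

  -- Consequently every cycle is a directed cycle, in one of its two directions.  If
  -- its first edge is backwards, all edges are, and then the last vertex points to its
  -- predecessor, not to x₀.  If the first edge is forwards, x₀ points to x₁, so the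
  -- closing edge points into x₀; a backward edge would then propagate to the last
  -- edge, giving the last vertex two out-neighbours.
  Forward Backward : Cycle G → Set
  Forward c = (∀ i → Arc O (vtx c (inject₁ i)) (vtx c (suc i))) × Arc O (vtx c (fromℕ _)) (vtx c zero)
  Backward c = (∀ i → Arc O (vtx c (suc i)) (vtx c (inject₁ i))) × Arc O (vtx c zero) (vtx c (fromℕ _))

  cycle-directed : (c : Cycle G) → Forward c ⊎ Backward c
  cycle-directed c with edge⇒arc O _ _ (steps c zero) | edge⇒arc O _ _ (closing c)
  ... | inj₂ back₀ | inj₂ first→last =
    inj₂ (backward-from-start (vtx c) (steps c) (cycle-gaps c) back₀ , first→last)
  ... | inj₂ back₀ | inj₁ last→first =
    contradiction (inj c (outdeg last→first (backward-from-start (vtx c) (steps c) (cycle-gaps c) back₀ (fromℕ _))))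
                  λ ()
  ... | inj₁ first→second | inj₂ first→last = contradiction (inj c (outdeg first→second first→last)) λ ()
  ... | inj₁ _ | inj₁ last→first = inj₁ (forward , last→first)
    where
    forward : ∀ i → Arc O (vtx c (inject₁ i)) (vtx c (suc i))
    forward i with edge⇒arc O _ _ (steps c i)
    ... | inj₁ fwd = fwd
    ... | inj₂ back =
      contradiction (inj c (outdeg last→first (backward-at-end (vtx c) (steps c) (cycle-gaps c) i back))) λ ()

  -- No arc leaves a cycle: the out-neighbour of a cycle vertex is its successor
  -- on the directed cycle.
  closed : ∀ c {z w} → OnCycle c z → Arc O z w → CycEdge c z w
  closed c z-on with cycle-directed c
  closed c (i , refl) | inj₁ (forward , last→first) with inject₁-or-last i
  ... | inj₁ (j , refl) = λ arc → inj₁ (inj₁ (j , refl , outdeg (forward j) arc))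
  ... | inj₂ refl = λ arc → inj₁ (inj₂ (refl , outdeg last→first arc))
  closed c (zero , refl) | inj₂ (backward , first→last) =
    λ arc → inj₂ (inj₂ (outdeg first→last arc , refl))
  closed c (suc j , refl) | inj₂ (backward , first→last) =
    λ arc → inj₂ (inj₁ (j , outdeg (backward j) arc , refl))

  strongly-connected : ∀ c {y u} → OnCycle c y → OnCycle c u → Star (Arc O) y u
  strongly-connected c (i , refl) (j , refl) with cycle-directed c
  ... | inj₁ (forward , last→first) =
    walk-to-last (Arc O) (vtx c) forward i ◅◅ (last→first ◅ walk-from-first (Arc O) (vtx c) forward j)
  ... | inj₂ (backward , first→last) =
    reverse id (walk-from-first (flip (Arc O)) (vtx c) backward i)
      ◅◅ (first→last ◅ reverse id (walk-to-last (flip (Arc O)) (vtx c) backward j))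

  stays-on-cycle : ∀ c {z y} → Star (Arc O) z y → OnCycle c z → OnCycle c y
  stays-on-cycle c ε z-on = z-on
  stays-on-cycle c (arc ◅ walk) z-on = stays-on-cycle c walk (proj₂ (cycEdge-ends c (closed c z-on arc)))

  -- Two cycles through a common vertex y have the same vertices: every vertex of the
  -- first is reached from y, and arc-walks from y stay on the second.
  common-vertex⇒same-vertices : ∀ c₁ c₂ {y t} → OnCycle c₁ y → OnCycle c₂ y → OnCycle c₁ t → OnCycle c₂ t
  common-vertex⇒same-vertices c₁ c₂ y-on₁ y-on₂ t-on₁ =
    stays-on-cycle c₂ (strongly-connected c₁ y-on₁ t-on₁) y-on₂

  -- They also have the same edges: the tail of an edge of the first cycle (for the
  -- orientation O) lies on the second, and the only arc leaving it is a cycle edge.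
  common-vertex⇒same-edges : ∀ c₁ c₂ {y u w} → OnCycle c₁ y → OnCycle c₂ y → CycEdge c₁ u w → CycEdge c₂ u w
  common-vertex⇒same-edges c₁ c₂ {y} {u} {w} y-on₁ y-on₂ uw
    with cycEdge-ends c₁ uw | edge⇒arc O u w (cycEdge⇒Edge c₁ uw)
  ... | u-on₁ , _ | inj₁ u→w = closed c₂ (common-vertex⇒same-vertices c₁ c₂ y-on₁ y-on₂ u-on₁) u→w
  ... | _ , w-on₁ | inj₂ w→u =
    cycEdge-sym c₂ (closed c₂ (common-vertex⇒same-vertices c₁ c₂ y-on₁ y-on₂ w-on₁) w→u)

  ReachesCycle : Cycle G → Fin n → Set
  ReachesCycle c z = ∃ λ y → Star (Arc O) z y × OnCycle c y

  -- This property spreads along edges ab.  If a→b, the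
  -- walk from a is either empty (a is on the cycle, hence so is b) or starts with
  -- the unique arc out of a, namely a→b.
  reaches-across-edge : ∀ c {a b} → Edge G a b → ReachesCycle c a → ReachesCycle c b
  reaches-across-edge c {a} {b} ab (y , walk , y-on) with edge⇒arc O a b ab
  ... | inj₂ b→a = y , b→a ◅ walk , y-on
  reaches-across-edge c ab (y , ε , y-on) | inj₁ a→b = _ , ε , proj₂ (cycEdge-ends c (closed c y-on a→b))
  reaches-across-edge c ab (y , a→a′ ◅ walk , y-on) | inj₁ a→b with outdeg a→a′ a→b
  ... | refl = y , walk , y-on

  reaches-along-walk : ∀ c {a b} → Star (Edge G) a b → ReachesCycle c a → ReachesCycle c b
  reaches-along-walk c ε reaches = reaches
  reaches-along-walk c (ab ◅ walk) reaches = reaches-along-walk c walk (reaches-across-edge c ab reaches)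

  -- In a connected graph any two cycles meet: walk from the first to the second,
  -- then follow arcs from there onto the first; the arcs stay on the second.
  cycles-meet : Connected G → ∀ c₁ c₂ → ∃ λ y → OnCycle c₁ y × OnCycle c₂ y
  cycles-meet connected c₁ c₂
    with reaches-along-walk c₁ (connected (vtx c₁ zero) (vtx c₂ zero)) (vtx c₁ zero , ε , zero , refl)
  ... | y , walk , y-on₁ = y , y-on₁ , stays-on-cycle c₂ walk (zero , refl)

  at-most-one-cycle : Connected G → AtMostOneCycle G
  at-most-one-cycle connected c₁ c₂ u w = same-edges c₁ c₂ , same-edges c₂ c₁
    where
    same-edges : ∀ c c′ → CycEdge c u w → CycEdge c′ u w
    same-edges c c′ with cycles-meet connected c c′
    ... | y , y-on , y-on′ = common-vertex⇒same-edges c c′ y-on y-on′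

-- (3) A graph with at most one cycle has an orientation of out-degree ≤ 1.

record ParentMap {m} (H : Graph m) : Set where
  field
    parent      : Fin m → Maybe (Fin m)
    parent-edge : ∀ u w → parent u ≡ just w → Edge H u w
    covers      : ∀ u w → Edge H u w → parent u ≡ just w ⊎ parent w ≡ just u
    not-mutual  : ∀ u w → parent u ≡ just w → parent w ≢ just u
open ParentMap

points-to : ∀ {m} → Maybe (Fin m) → Fin m → Bool
points-to nothing w = false
points-to (just z) w = does (z ≟ w)

points-to⁺ : ∀ {m} {mz : Maybe (Fin m)} {w} → mz ≡ just w → points-to mz w ≡ true
points-to⁺ {w = w} refl = dec-true (w ≟ w) refl

points-to⁻ : ∀ {m} (mz : Maybe (Fin m)) {w} → points-to mz w ≡ true → mz ≡ just w
points-to⁻ (just z) {w} pz = cong just (dec-true⁻ (z ≟ w) pz)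
  where
  dec-true⁻ : ∀ {P : Set} (p? : Dec P) → does p? ≡ true → P
  dec-true⁻ (yes p) _ = p

parent-map⇒orientation : ∀ {m} {H : Graph m} → ParentMap H → Σ (Orientation H) OutDegree≤1
parent-map⇒orientation {m} {H} R =
  O , λ {v} a b → just-injective (trans (sym (points-to⁻ (parent R v) a)) (points-to⁻ (parent R v) b))
  where
  O : Orientation H
  O = record
    { arc = λ u w → points-to (parent R u) w
    ; arc⇒edge = λ u w a → parent-edge R u w (points-to⁻ _ a)
    ; edge⇒arc = λ u w e → Data.Sum.map points-to⁺ points-to⁺ (covers R u w e)
    ; antisym = not-both-ways
    }
    where
    not-both-ways : ∀ u w → points-to (parent R u) w ≡ true → points-to (parent R w) u ≡ false
    not-both-ways u w a with points-to (parent R w) u in a′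
    ... | true = ⊥-elim (not-mutual R u w (points-to⁻ _ a) (points-to⁻ _ a′))
    ... | false = refl

edge? : ∀ {m} (H : Graph m) u w → Dec (Edge H u w)
edge? H u w = adj H u w Data.Bool.Properties.≟ true

Branching : ∀ {m} → Graph m → Fin m → Set
Branching H v = ∃ λ a → ∃ λ b → Edge H v a × Edge H v b × a ≢ b

data Neighbourhood {m} (H : Graph m) (v : Fin m) : Set where
  isolated  : (∀ w → ¬ Edge H v w) → Neighbourhood H v
  leaf      : ∀ a → Edge H v a → (∀ w → Edge H v w → w ≡ a) → Neighbourhood H v
  branching : Branching H v → Neighbourhood H v

neighbourhood : ∀ {m} (H : Graph m) v → Neighbourhood H v
neighbourhood H v with any? (edge? H v)
... | no none = isolated λ w vw → none (w , vw)
... | yes (a , va) with any? (λ w → edge? H v w ×-dec ¬? (w ≟ a))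
...   | yes (b , vb , b≢a) = branching (a , b , va , vb , b≢a ∘ sym)
...   | no no-other = leaf a va λ w vw → decidable-stable (w ≟ a) λ w≢a → no-other (w , vw , w≢a)

branching? : ∀ {m} (H : Graph m) v → Dec (Branching H v)
branching? H v with neighbourhood H v
... | isolated none = no λ (a , _ , va , _) → none a va
... | leaf a _ only-a = no λ (b , c , vb , vc , b≢c) → b≢c (trans (only-a b vb) (sym (only-a c vc)))
... | branching two = yes two

close-cycle : ∀ {m} {H : Graph m} k (p : Fin (suc (suc k)) → Fin m) → Injective _≡_ _≡_ p → IsWalk H p →
              (j : Fin k) → Edge H (p (suc (suc j))) (p zero) → Cycle H
close-cycle (suc K) p distinct linked j closing-edge with inject₁-or-last j
... | inj₂ refl = record { len = K ; vtx = p ; inj = distinct ; steps = linked ; closing = closing-edge }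
... | inj₁ (j′ , refl) =
  close-cycle K (p ∘ inject₁) (inject₁-injective ∘ distinct) (linked ∘ inject₁) j′ closing-edge

-- If every vertex other than x is branching (and there is such a vertex), H has a
-- cycle: grow a path at its head, always leaving the head by an edge other than
-- the one it was entered by, until the new neighbour already lies on the path.
module GreedyCycle {m} (H : Graph m) (x : Fin m) (branches : ∀ v → v ≢ x → Branching H v) where

  -- The head of the path is never x: either x lies on the path already (and the
  -- path only grows by new vertices), or x is isolated.
  record Path (k : ℕ) : Set where
    field
      vertex    : Fin (suc (suc k)) → Fin m
      distinct  : Injective _≡_ _≡_ vertex
      linked    : IsWalk H vertex
      x-on-path-or-isolated : (∃ λ j → vertex j ≡ x) ⊎ (∀ u → ¬ Edge H x u)
      head≢x    : vertex zero ≢ x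
  open Path

  edge-path : ∀ {a b} → Edge H a b → a ≢ x → b ≡ x ⊎ (∀ u → ¬ Edge H x u) → Path 0
  edge-path {a} {b} ab a≢x b≡x-or-isolated = record
    { vertex = λ { zero → a ; (suc zero) → b }
    ; distinct = λ { {zero} {zero} _ → refl ; {zero} {suc zero} a≡b → contradiction a≡b (edge⇒≢ H ab)
                   ; {suc zero} {zero} b≡a → contradiction (sym b≡a) (edge⇒≢ H ab) ; {suc zero} {suc zero} _ → refl }
    ; linked = λ { zero → ab }
    ; x-on-path-or-isolated = Data.Sum.map₁ (suc zero ,_) b≡x-or-isolated
    ; head≢x = a≢x
    }

  extend : ∀ {k} (P : Path k) {w} → Edge H w (vertex P zero) → (∀ j → vertex P j ≢ w) → Path (suc k)
  extend P {w} w-head new = record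
    { vertex = vertex′
    ; distinct = distinct′
    ; linked = λ { zero → w-head ; (suc i) → linked P i }
    ; x-on-path-or-isolated = Data.Sum.map₁ (λ (j , j≡x) → suc j , j≡x) (x-on-path-or-isolated P)
    ; head≢x = w≢x (x-on-path-or-isolated P)
    }
    where
    vertex′ : Fin (suc (suc (suc _))) → Fin m
    vertex′ zero = w
    vertex′ (suc i) = vertex P i
    distinct′ : Injective _≡_ _≡_ vertex′
    distinct′ {zero} {zero} _ = refl
    distinct′ {zero} {suc j} w≡ = contradiction (sym w≡) (new j)
    distinct′ {suc i} {zero} ≡w = contradiction ≡w (new i)
    distinct′ {suc i} {suc j} eq = cong suc (distinct P eq)
    w≢x : (∃ λ j → vertex P j ≡ x) ⊎ (∀ u → ¬ Edge H x u) → w ≢ x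
    w≢x (inj₁ (j , j≡x)) w≡x = new j (trans j≡x (sym w≡x))
    w≢x (inj₂ x-isolated) refl = x-isolated _ w-head

  fresh-neighbour : ∀ {k} (P : Path k) → ∃ λ w → Edge H (vertex P zero) w × w ≢ vertex P (suc zero)
  fresh-neighbour P with branches (vertex P zero) (head≢x P)
  ... | a , b , ea , eb , a≢b with a ≟ vertex P (suc zero)
  ...   | yes a≡next = b , eb , λ b≡next → a≢b (trans a≡next (sym b≡next))
  ...   | no a≢next = a , ea , a≢next

  -- Paths are injective, hence have at most m vertices, so fuel bounds the number
  -- of extensions still possible.
  grow : ∀ fuel k → m ≤ fuel + suc k → Path k → Cycle H
  grow zero k bound P = contradiction (≤-trans (injective⇒≤ (distinct P)) bound) (n≮n (suc k))
  grow (suc fuel) k bound P with fresh-neighbour P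
  ... | w , head-w , w≢next with any? (λ j → vertex P j ≟ w)
  ...   | yes (zero , head≡w) = contradiction head≡w (edge⇒≢ H head-w)
  ...   | yes (suc zero , next≡w) = contradiction (sym next≡w) w≢next
  ...   | yes (suc (suc j) , j≡w) =
    close-cycle k (vertex P) (distinct P) (linked P) j
      (subst (λ z → Edge H z (vertex P zero)) (sym j≡w) (edge-sym H head-w))
  ...   | no new = grow fuel (suc k) (subst (m ≤_) (sym (+-suc fuel (suc k))) bound)
                        (extend P (edge-sym H head-w) λ j j≡w → new (j , j≡w))

  cycle : ∀ v₀ → v₀ ≢ x → Cycle H
  cycle v₀ v₀≢x = grow m 0 (m≤m+n m 1) start
    where
    start : Path 0
    start with any? (edge? H x)
    ... | yes (y , xy) = edge-path (edge-sym H xy) (edge⇒≢ H xy ∘ sym) (inj₁ refl)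
    ... | no none with branches v₀ v₀≢x
    ...   | a , _ , v₀a , _ =
      edge-path (edge-sym H v₀a) (λ { refl → none (v₀ , edge-sym H v₀a) }) (inj₂ λ u xu → none (u , xu))

-- Deleting a vertex v; the remaining vertices are renumbered by punchIn v.
delete-vertex : ∀ {m} → Graph (suc m) → Fin (suc m) → Graph m
delete-vertex H v = record
  { adj = λ u w → adj H (punchIn v u) (punchIn v w)
  ; sym = λ u w → Graph.sym H (punchIn v u) (punchIn v w)
  ; irrefl = λ u → irrefl H (punchIn v u)
  }

lift-cycle : ∀ {m} (H : Graph (suc m)) v → Cycle (delete-vertex H v) → Cycle H
lift-cycle H v c = record
  { len = len c ; vtx = punchIn v ∘ vtx c ; inj = inj c ∘ punchIn-injective v _ _
  ; steps = steps c ; closing = closing c }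

deleted-or-kept : ∀ {m} (v w : Fin (suc m)) → w ≡ v ⊎ ∃ λ u → w ≡ punchIn v u
deleted-or-kept v w with v ≟ w
... | yes v≡w = inj₁ (sym v≡w)
... | no v≢w = inj₂ (punchOut v≢w , sym (punchIn-punchOut v≢w))

-- A parent map of H - v extends to H when v has at most one neighbour, by letting
-- v point to that neighbour (pv); this pointer covers every edge at v.
module ExtendParentMap {m} (H : Graph (suc m)) (v : Fin (suc m)) (pv : Maybe (Fin (suc m)))
         (pv-edge : ∀ w → pv ≡ just w → Edge H v w) (pv-covers : ∀ w → Edge H v w → pv ≡ just w)
         (R : ParentMap (delete-vertex H v)) where

  parent′ : Fin (suc m) → Maybe (Fin (suc m))
  parent′ w with v ≟ w
  ... | yes _ = pv
  ... | no v≢w = Data.Maybe.map (punchIn v) (parent R (punchOut v≢w))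

  parent′-deleted : parent′ v ≡ pv
  parent′-deleted with v ≟ v
  ... | yes _ = refl
  ... | no v≢v = contradiction refl v≢v

  parent′-kept : ∀ u → parent′ (punchIn v u) ≡ Data.Maybe.map (punchIn v) (parent R u)
  parent′-kept u with v ≟ punchIn v u
  ... | yes v≡u = contradiction (sym v≡u) (punchInᵢ≢i v u)
  ... | no v≢u =
    cong (Data.Maybe.map (punchIn v) ∘ parent R) (trans (punchOut-cong v refl) (punchOut-punchIn v))

  parent′-kept⁻ : ∀ u {y} → parent′ (punchIn v u) ≡ just y → ∃ λ z → parent R u ≡ just z × y ≡ punchIn v z
  parent′-kept⁻ u p≡y with parent R u | parent′-kept u
  ... | just z | p≡z = z , refl , just-injective (trans (sym p≡y) p≡z)
  ... | nothing | p≡nothing = contradiction (trans (sym p≡y) p≡nothing) λ ()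

  extended : ParentMap H
  extended = record
    { parent = parent′ ; parent-edge = parent-edge′ ; covers = covers′ ; not-mutual = not-mutual′ }
    where
    parent-edge′ : ∀ u w → parent′ u ≡ just w → Edge H u w
    parent-edge′ u w p≡w with deleted-or-kept v u
    ... | inj₁ refl = pv-edge w (trans (sym parent′-deleted) p≡w)
    ... | inj₂ (u′ , refl) with parent′-kept⁻ u′ p≡w
    ...   | z , p≡z , refl = parent-edge R u′ z p≡z

    covers′ : ∀ u w → Edge H u w → parent′ u ≡ just w ⊎ parent′ w ≡ just u
    covers′ u w uw with deleted-or-kept v u | deleted-or-kept v w
    ... | inj₁ refl | _ = inj₁ (trans parent′-deleted (pv-covers w uw))
    ... | inj₂ _ | inj₁ refl = inj₂ (trans parent′-deleted (pv-covers u (edge-sym H uw)))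
    ... | inj₂ (u′ , refl) | inj₂ (w′ , refl) =
      Data.Sum.map (λ p≡w → trans (parent′-kept u′) (cong (Data.Maybe.map (punchIn v)) p≡w))
                   (λ p≡u → trans (parent′-kept w′) (cong (Data.Maybe.map (punchIn v)) p≡u))
                   (covers R u′ w′ uw)

    not-mutual′ : ∀ u w → parent′ u ≡ just w → parent′ w ≢ just u
    not-mutual′ u w p≡w p≡u with deleted-or-kept v u | deleted-or-kept v w
    ... | inj₁ refl | inj₁ refl = edge⇒≢ H (pv-edge v (trans (sym parent′-deleted) p≡w)) refl
    ... | inj₁ refl | inj₂ (w′ , refl) = punchInᵢ≢i v _ (sym (proj₂ (proj₂ (parent′-kept⁻ w′ p≡u))))
    ... | inj₂ (u′ , refl) | inj₁ refl = punchInᵢ≢i v _ (sym (proj₂ (proj₂ (parent′-kept⁻ u′ p≡w))))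
    ... | inj₂ (u′ , refl) | inj₂ (w′ , refl)
      with parent′-kept⁻ u′ p≡w | parent′-kept⁻ w′ p≡u
    ...   | z , p≡z , w≡z | z′ , p≡z′ , u≡z′
      with punchIn-injective v _ _ w≡z | punchIn-injective v _ _ u≡z′
    ...     | refl | refl = not-mutual R u′ w′ p≡z p≡z′

  root-kept : ∀ u → parent R u ≡ nothing → parent′ (punchIn v u) ≡ nothing
  root-kept u root = trans (parent′-kept u) (cong (Data.Maybe.map (punchIn v)) root)

Rooted : ∀ {m} {H : Graph m} → ParentMap H → Fin m → Set
Rooted R x = parent R x ≡ nothing

-- Every graph has a cycle or a parent map rooted at any prescribed vertex x:
-- delete a non-branching vertex v ≠ x, recurse, and let v point to its neighbour
-- (if any); when there is no such v, every vertex but x branches and the greedy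
-- search finds a cycle.
rooted-or-cycle : ∀ n (H : Graph (suc n)) x → (Σ (ParentMap H) λ R → Rooted R x) ⊎ Cycle H
rooted-or-cycle zero H x = inj₁ (empty , refl)
  where
  empty : ParentMap H
  empty = record
    { parent = λ _ → nothing ; parent-edge = λ _ _ () ; not-mutual = λ _ _ ()
    ; covers = λ { zero zero loop → contradiction refl (edge⇒≢ H loop) } }
rooted-or-cycle (suc n) H x with any? (λ v → ¬? (v ≟ x) ×-dec ¬? (branching? H v))
... | no all-branch = inj₂ (GreedyCycle.cycle H x branches (punchIn x zero) (punchInᵢ≢i x zero))
  where
  branches : ∀ v → v ≢ x → Branching H v
  branches v v≢x = decidable-stable (branching? H v) λ ¬branching → all-branch (v , v≢x , ¬branching)
... | yes (v , v≢x , v-not-branching) = delete-and-extend (neighbourhood H v)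
  where
  extend-by : (pv : Maybe (Fin (suc (suc n)))) →
              (∀ w → pv ≡ just w → Edge H v w) → (∀ w → Edge H v w → pv ≡ just w) →
              (Σ (ParentMap H) λ R → Rooted R x) ⊎ Cycle H
  extend-by pv pv-edge pv-covers with rooted-or-cycle n (delete-vertex H v) (punchOut v≢x)
  ... | inj₂ c = inj₂ (lift-cycle H v c)
  ... | inj₁ (R , root) =
    inj₁ (extended , subst (Rooted extended) (punchIn-punchOut v≢x) (root-kept (punchOut v≢x) root))
    where open ExtendParentMap H v pv pv-edge pv-covers R

  delete-and-extend : Neighbourhood H v → (Σ (ParentMap H) λ R → Rooted R x) ⊎ Cycle H
  delete-and-extend (isolated none) = extend-by nothing (λ _ ()) (λ w vw → ⊥-elim (none w vw))
  delete-and-extend (leaf a va only-a) =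
    extend-by (just a) (λ { w refl → va }) (λ w vw → cong just (sym (only-a w vw)))
  delete-and-extend (branching two) = contradiction two v-not-branching

does-cong : ∀ {P Q : Set} (p? : Dec P) (q? : Dec Q) → (P → Q) → (Q → P) → does p? ≡ does q?
does-cong (yes _) (yes _) _ _ = refl
does-cong (no _) (no _) _ _ = refl
does-cong (yes p) (no ¬q) p⇒q _ = contradiction (p⇒q p) ¬q
does-cong (no ¬p) (yes q) _ q⇒p = contradiction (q⇒p q) ¬p

module _ {m} (G : Graph m) (p q : Fin m) where

  IsPQ : Fin m → Fin m → Set
  IsPQ u w = (u ≡ p × w ≡ q) ⊎ (u ≡ q × w ≡ p)

  isPQ? : ∀ u w → Dec (IsPQ u w)
  isPQ? u w = (u ≟ p ×-dec w ≟ q) ⊎-dec (u ≟ q ×-dec w ≟ p)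

  isPQ-flip : ∀ {u w} → IsPQ u w → IsPQ w u
  isPQ-flip (inj₁ (u≡p , w≡q)) = inj₂ (w≡q , u≡p)
  isPQ-flip (inj₂ (u≡q , w≡p)) = inj₁ (w≡p , u≡q)

  isPQ-sym : ∀ u w → does (isPQ? u w) ≡ does (isPQ? w u)
  isPQ-sym u w = does-cong (isPQ? u w) (isPQ? w u) isPQ-flip isPQ-flip

  delete-edge : Graph m
  delete-edge = record
    { adj = λ u w → adj G u w ∧ not (does (isPQ? u w))
    ; sym = λ u w → cong₂ _∧_ (Graph.sym G u w) (cong not (isPQ-sym u w))
    ; irrefl = λ u → cong (_∧ not (does (isPQ? u u))) (irrefl G u)
    }

  kept-edge⁻ : ∀ {u w} → Edge delete-edge u w → Edge G u w × ¬ IsPQ u w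
  kept-edge⁻ {u} {w} uw with ∧-true⁻ (adj G u w) _ uw
  ... | uw′ , not-pq =
    uw′ , λ pq → contradiction (trans (sym (cong not (dec-true (isPQ? u w) pq))) not-pq) λ ()

  kept-edge⁺ : ∀ {u w} → Edge G u w → ¬ IsPQ u w → Edge delete-edge u w
  kept-edge⁺ {u} {w} uw ¬pq = cong₂ _∧_ uw (cong not (dec-false (isPQ? u w) ¬pq))

  lift-cycle-edge : Cycle delete-edge → Cycle G
  lift-cycle-edge c = record
    { len = len c ; vtx = vtx c ; inj = inj c
    ; steps = proj₁ ∘ kept-edge⁻ ∘ steps c ; closing = proj₁ (kept-edge⁻ (closing c)) }

  module RestoreEdge (pq : Edge G p q) (R : ParentMap delete-edge) (root : Rooted R p) where

    parent′ : Fin m → Maybe (Fin m)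
    parent′ u with u ≟ p
    ... | yes _ = just q
    ... | no _ = parent R u

    parent′-p : parent′ p ≡ just q
    parent′-p with p ≟ p
    ... | yes _ = refl
    ... | no p≢p = contradiction refl p≢p

    parent′-other : ∀ {u} → u ≢ p → parent′ u ≡ parent R u
    parent′-other {u} u≢p with u ≟ p
    ... | yes u≡p = contradiction u≡p u≢p
    ... | no _ = refl

    q≢p : q ≢ p
    q≢p = edge⇒≢ G pq ∘ sym

    -- Edges at p: pq is covered by p → q, any other edge pw by R, which cannot point from the root p.
    covers-at-p : ∀ w → Edge G p w → parent′ p ≡ just w ⊎ parent′ w ≡ just p
    covers-at-p w pw with w ≟ q
    ... | yes refl = inj₁ parent′-p
    ... | no w≢q
      with covers R p w (kept-edge⁺ pw λ { (inj₁ (_ , w≡q)) → w≢q w≡q ; (inj₂ (p≡q , _)) → q≢p (sym p≡q) })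
    ...   | inj₁ p→w = contradiction (trans (sym root) p→w) λ ()
    ...   | inj₂ w→p = inj₂ (trans (parent′-other (edge⇒≢ G pw ∘ sym)) w→p)

    -- Pointers out of p and back: p → q and q → p would make qp an edge of G - pq.
    not-mutual-at-p : ∀ w → parent′ p ≡ just w → parent′ w ≢ just p
    not-mutual-at-p w p→w w→p with just-injective (trans (sym parent′-p) p→w)
    ... | refl =
      proj₂ (kept-edge⁻ (parent-edge R q p (trans (sym (parent′-other q≢p)) w→p))) (inj₂ (refl , refl))

    restored : ParentMap G
    restored = record
      { parent = parent′ ; parent-edge = parent-edge′ ; covers = covers′ ; not-mutual = not-mutual′ }
      where
      parent-edge′ : ∀ u w → parent′ u ≡ just w → Edge G u w
      parent-edge′ u w u→w with toSum (u ≟ p)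
      ... | inj₁ refl = subst (Edge G p) (just-injective (trans (sym parent′-p) u→w)) pq
      ... | inj₂ u≢p = proj₁ (kept-edge⁻ (parent-edge R u w (trans (sym (parent′-other u≢p)) u→w)))

      covers′ : ∀ u w → Edge G u w → parent′ u ≡ just w ⊎ parent′ w ≡ just u
      covers′ u w uw with toSum (u ≟ p) | toSum (w ≟ p)
      ... | inj₁ refl | _ = covers-at-p w uw
      ... | inj₂ _ | inj₁ refl = Data.Sum.swap (covers-at-p u (edge-sym G uw))
      ... | inj₂ u≢p | inj₂ w≢p =
        Data.Sum.map (trans (parent′-other u≢p)) (trans (parent′-other w≢p))
          (covers R u w (kept-edge⁺ uw λ { (inj₁ (u≡p , _)) → u≢p u≡p ; (inj₂ (_ , w≡p)) → w≢p w≡p }))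

      not-mutual′ : ∀ u w → parent′ u ≡ just w → parent′ w ≢ just u
      not-mutual′ u w u→w w→u with toSum (u ≟ p) | toSum (w ≟ p)
      ... | inj₁ refl | _ = not-mutual-at-p w u→w w→u
      ... | inj₂ _ | inj₁ refl = not-mutual-at-p u w→u u→w
      ... | inj₂ u≢p | inj₂ w≢p =
        not-mutual R u w (trans (sym (parent′-other u≢p)) u→w) (trans (sym (parent′-other w≢p)) w→u)

-- If it has a cycle, delete one of
-- its edges pq: a cycle of G - pq would be a second cycle of G, so G - pq has a parent
-- map rooted at p, and p → q restores the edge.
parent-map : ∀ {n} (G : Graph n) → AtMostOneCycle G → ParentMap G
parent-map {zero} G _ = record { parent = λ () ; parent-edge = λ () ; covers = λ () ; not-mutual = λ () }
parent-map {suc n} G unique with rooted-or-cycle n G zero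
... | inj₁ (R , _) = R
... | inj₂ C = break-cycle (vtx C (fromℕ _)) (vtx C zero) (inj₁ (inj₂ (refl , refl)))
  where
  break-cycle : ∀ p q → CycEdge C p q → ParentMap G
  break-cycle p q pq-on-C with rooted-or-cycle n (delete-edge G p q) p
  ... | inj₁ (R , root) = RestoreEdge.restored G p q (cycEdge⇒Edge C pq-on-C) R root
  ... | inj₂ C′ = contradiction (inj₁ (refl , refl)) (proj₂ (kept-edge⁻ G p q pq-in-G-pq))
    where
    pq-in-G-pq : Edge (delete-edge G p q) p q
    pq-in-G-pq = cycEdge⇒Edge C′ (proj₁ (unique C (lift-cycle-edge G p q C′) p q) pq-on-C)

theorem6p1 : ∀ (n : ℕ) (G : Graph n) → Connected G →
    (β⃗≤ G 1 1 → AtMostOneCycle G) × (AtMostOneCycle G → β⃗≤ G 1 1)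
theorem6p1 n G connected = unique-cycle , orient
  where
  unique-cycle : β⃗≤ G 1 1 → AtMostOneCycle G
  unique-cycle (O , contained) = OneCycle.at-most-one-cycle O (contained⇒OutDegree≤1 O contained) connected

  orient : AtMostOneCycle G → β⃗≤ G 1 1
  orient unique with parent-map⇒orientation (parent-map G unique)
  ... | O , outdeg = O , OutDegree≤1⇒contained O outdeg
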